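{- Let $H$ be a graph whose maximum degree $\Delta(H)$ is even and satisfies $\Delta(H)-\delta(H)\leq 2$, where $\delta(H)$ is the minimum degree of $H$. Let $G$ be the full subdivision of $H$. Then $G$ admits a cyclic interval $\Delta(G)$-coloring.
   Context: All graphs are finite and undirected; multiple edges are allowed, loops are not. The full subdivision of a graph is obtained by replacing each edge by a path of length $2$. A proper $t$-edge coloring of $G$ is a map $\alpha:E(G)\to\{1,\dots,t\}$ with $\alpha(e)\neq\alpha(e')$ for adjacent edges $e,e'$; $S(v,\alpha)$ is the set of colors on edges incident to $v$. A proper $t$-edge coloring $\alpha$ is a cyclic interval $t$-coloring if for every vertex $v$, either $S(v,\alpha)$ or $\{1,\dots,t\}\setminus S(v,\alpha)$ is a set of consecutive integers. -}

module Defs where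

open import Data.Nat using (ℕ; zero; suc; _+_; _≤_; _⊔_; _⊓_)
open import Data.Fin using (Fin; _↑ˡ_; _↑ʳ_; splitAt)
open import Data.Fin.Properties using (splitAt-↑ˡ; splitAt-↑ʳ) renaming (_≟_ to _≟F_)
open import Data.List using (List; length; filter; foldr; map)
open import Data.List.Base using (allFin)
open import Data.Product using (_×_; _,_; proj₁; proj₂; ∃; ∃-syntax; Σ)
open import Data.Sum using (_⊎_; inj₁; inj₂; [_,_])
open import Data.Sum.Relation.Unary.All using ()
open import Relation.Nullary using (¬_; Dec)
open import Relation.Nullary.Decidable using (_⊎-dec_)
open import Relation.Binary.PropositionalEquality using (_≡_; _≢_; refl; cong; trans; sym)

record Graph : Set where
  field
    V    : ℕ
    E    : ℕ
    ends : Fin E → Fin V × Fin V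
    loopless : ∀ e → proj₁ (ends e) ≢ proj₂ (ends e)
open Graph public

Incident : (G : Graph) → Fin (V G) → Fin (E G) → Set
Incident G v e = proj₁ (ends G e) ≡ v ⊎ proj₂ (ends G e) ≡ v

incident? : (G : Graph) (v : Fin (V G)) (e : Fin (E G)) → Dec (Incident G v e)
incident? G v e = (proj₁ (ends G e) ≟F v) ⊎-dec (proj₂ (ends G e) ≟F v)

-- degree = number of incident edges (no loops, so this is the usual degree)
degree : (G : Graph) → Fin (V G) → ℕ
degree G v = length (filter (incident? G v) (allFin (E G)))

-- maximum degree Δ(G) (0 for the graph with no vertices)
maxDegree : Graph → ℕ
maxDegree G = foldr _⊔_ 0 (map (degree G) (allFin (V G)))

-- minimum degree δ(G); for V ≥ 1 this is the minimum of the degrees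
-- (the start value Δ(G) does not affect the minimum of a nonempty list)
minDegree : Graph → ℕ
minDegree G = foldr _⊓_ (maxDegree G) (map (degree G) (allFin (V G)))

Adjacent : (G : Graph) → Fin (E G) → Fin (E G) → Set
Adjacent G e e' = e ≢ e' × ∃[ v ] (Incident G v e × Incident G v e')

record ProperEdgeColoring (G : Graph) (t : ℕ) : Set where
  field
    col      : Fin (E G) → ℕ
    inRange  : ∀ e → 1 ≤ col e × col e ≤ t
    proper   : ∀ e e' → Adjacent G e e' → col e ≢ col e'
open ProperEdgeColoring public

InS : {G : Graph} {t : ℕ} → ProperEdgeColoring G t → Fin (V G) → ℕ → Set
InS {G} α v c = ∃[ e ] (Incident G v e × col α e ≡ c)

-- a set of integers (given as a predicate) is a set of consecutive integers
-- (the empty set counts, taking a > b)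
Consecutive : (ℕ → Set) → Set
Consecutive X = ∃[ a ] ∃[ b ] (∀ c → (X c → a ≤ c × c ≤ b) × (a ≤ c × c ≤ b → X c))

record CyclicIntervalColoring (G : Graph) (t : ℕ) : Set where
  field
    coloring : ProperEdgeColoring G t
    cyclic   : ∀ v → Consecutive (InS coloring v)
                   ⊎ Consecutive (λ c → (1 ≤ c × c ≤ t) × ¬ InS coloring v c)

-- full subdivision: vertices = old vertices (Fin V, via ↑ˡ) followed by one new
-- vertex per edge (Fin E, via ↑ʳ); edge e = uv becomes edges (u, w_e) and (w_e, v).
private
  ↑ˡ≢↑ʳ : ∀ {m n} (i : Fin m) (j : Fin n) → (i ↑ˡ n) ≢ (m ↑ʳ j)
  ↑ˡ≢↑ʳ {m} {n} i j eq with trans (sym (splitAt-↑ˡ m i n)) (trans (cong (splitAt m) eq) (splitAt-↑ʳ m n j))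
  ... | ()

subdivEnds : (H : Graph) → Fin (E H + E H) → Fin (V H + E H) × Fin (V H + E H)
subdivEnds H i =
  [ (λ e → (proj₁ (ends H e) ↑ˡ E H , V H ↑ʳ e))
  , (λ e → (V H ↑ʳ e , proj₂ (ends H e) ↑ˡ E H)) ] (splitAt (E H) i)

subdivLoopless : (H : Graph) → ∀ i → proj₁ (subdivEnds H i) ≢ proj₂ (subdivEnds H i)
subdivLoopless H i with splitAt (E H) i
... | inj₁ e = ↑ˡ≢↑ʳ (proj₁ (ends H e)) e
... | inj₂ e = λ eq → ↑ˡ≢↑ʳ (proj₂ (ends H e)) e (sym eq)

fullSubdivision : Graph → Graph
fullSubdivision H = record
  { V = V H + E H
  ; E = E H + E H
  ; ends = subdivEnds H
  ; loopless = subdivLoopless H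
  }

-- Write Δ(H) = 2K and call the two halves of an edge of H its darts: they are exactly the edges of the full
-- subdivision G. The dart h of the edge e gets the colour 2β(e) + o(h) + 1, where o(h) ∈ {0, 1} orients e and
-- β(e) < K, so a subdivision vertex sees the two consecutive colours 2β(e) + 1 and 2β(e) + 2.
-- Number the darts at each vertex of H and group them in slots of two. A proper 2-edge-colouring (König) of the
-- bipartite graph joining the slot of every dart to its edge orients H so that each slot holds at most one dart of
-- each orientation; hence every vertex has at most K darts of each orientation, and at least K - 1 since δ(H) ≥ 2K - 2.
-- Join the orientation-0 end of every edge to its orientation-1 end, and add at every vertex a filler edge on each side
-- whose last slot is free: now every vertex of H has K edges on each side, so König gives β taking every value there.
-- The colours missing at a vertex of H are therefore among the two consecutive colours of its filler edge.

module Submission where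

open import Defs
open import Data.Bool using (if_then_else_)
open import Data.Empty using (⊥-elim)
open import Data.Nat using (ℕ; zero; suc; _+_; _*_; _∸_; _≤_; _<_; _≤?_; z≤n; s≤s; _⊔_; _⊓_)
open import Data.Nat.Properties
  using (1+n≰n; m<1+n⇒m<n∨m≡n; +-suc; ≤-refl; ≤-reflexive; ≤-trans; <-≤-trans; ≤-antisym; n≤1+n; m≤n⇒m<n∨m≡n;
         ⊔-lub; m⊔n≤o⇒m≤o; m⊔n≤o⇒n≤o; m≤n⊓o⇒m≤n; m≤n⊓o⇒m≤o; m≤n+m∸n; +-monoˡ-≤; +-comm; +-identityʳ; *-comm;
         +-cancelˡ-≤; module ≤-Reasoning)
import Data.Nat.Properties as ℕ
open import Data.Nat.Divisibility using (_∣_; divides)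
open import Data.Fin
  using (Fin; zero; suc; toℕ; fromℕ; fromℕ<; punchOut; _↑ˡ_; _↑ʳ_; splitAt; join; combine; quotient; remainder; remQuot)
  renaming (_<_ to _<ᶠ_)
open import Data.Fin.Properties
  using (any?; all?; ¬∀⟶∃¬; punchOut-injective; injective⇒≤; suc-injective; toℕ-injective; toℕ<n; toℕ-fromℕ<;
         toℕ-fromℕ; splitAt-↑ˡ; splitAt-↑ʳ; splitAt⁻¹-↑ˡ; splitAt⁻¹-↑ʳ; splitAt-join; join-splitAt; ↑ˡ-injective;
         ↑ʳ-injective; combine-injective; combine-surjective; toℕ-combine; remQuot-combine; combine-remQuot;
         combine-monoˡ-<; ≤fromℕ; ≤∧≢⇒<; _≟_)
open import Data.List using (filter; tabulate; length)
open import Data.List.Properties using (foldr-preservesᵇ; foldr-forcesᵇ)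
open import Data.List.Relation.Unary.All.Properties using (map⁺; map⁻; tabulate⁺; tabulate⁻)
open import Data.Product using (_×_; _,_; ∃; ∃₂; proj₁; proj₂)
open import Data.Product.Properties using () renaming (≡-dec to ×-≡-dec)
open import Data.Sum using (_⊎_; inj₁; inj₂; [_,_]; [_,_]′; reduce)
open import Data.Sum.Properties using (inj₁-injective; inj₂-injective) renaming (≡-dec to ⊎-≡-dec)
open import Data.Vec.Functional using (_∷_)
open import Function using (_∘_; _∘′_; const; id; Injective)
open import Relation.Nullary using (¬_; Dec; yes; no; does; contradiction; ¬?)
open import Relation.Nullary.Decidable using (_⊎-dec_; _×-dec_; toSum)
open import Relation.Unary using (Decidable; _≐_)
open import Relation.Binary.Definitions using (DecidableEquality)
open import Relation.Binary.PropositionalEquality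
  using (_≡_; _≢_; refl; sym; trans; cong; cong₂; subst; subst₂; module ≡-Reasoning)

-- Counting

count : ∀ {n} {P : Fin n → Set} → Decidable P → ℕ
count {zero}  P? = 0
count {suc n} P? = if does (P? zero) then suc (count (P? ∘ suc)) else count (P? ∘ suc)

rank : ∀ {n} {P : Fin n → Set} → Decidable P → Fin n → ℕ
rank P? zero    = 0
rank P? (suc i) = if does (P? zero) then suc (rank (P? ∘ suc) i) else rank (P? ∘ suc) i

rank<count : ∀ {n} {P : Fin n → Set} (P? : Decidable P) {i : Fin n} → P i → rank P? i < count P?
rank<count P? {zero} p with P? zero
... | yes _ = s≤s z≤n
... | no ¬p = contradiction p ¬p
rank<count P? {suc i} p with P? zero
... | yes _ = s≤s (rank<count (P? ∘ suc) p)
... | no _  = rank<count (P? ∘ suc) p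

rank-injective : ∀ {n} {P : Fin n → Set} (P? : Decidable P) {i j : Fin n} →
                 P i → P j → rank P? i ≡ rank P? j → i ≡ j
rank-injective P? {zero}  {zero}  _  _  _  = refl
rank-injective P? {zero}  {suc j} pi pj eq with P? zero
... | yes _ = contradiction eq λ ()
... | no ¬p = contradiction pi ¬p
rank-injective P? {suc i} {zero}  pi pj eq with P? zero
... | yes _ = contradiction eq λ ()
... | no ¬p = contradiction pj ¬p
rank-injective P? {suc i} {suc j} pi pj eq with P? zero
... | yes _ = cong suc (rank-injective (P? ∘ suc) pi pj (ℕ.suc-injective eq))
... | no _  = cong suc (rank-injective (P? ∘ suc) pi pj eq)

rank-suc-yes : ∀ {n} {P : Fin (suc n) → Set} (P? : Decidable P) {i : Fin n} →
               P zero → rank P? (suc i) ≡ suc (rank (P? ∘ suc) i)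
rank-suc-yes P? p with P? zero
... | yes _ = refl
... | no ¬p = contradiction p ¬p

rank-suc-no : ∀ {n} {P : Fin (suc n) → Set} (P? : Decidable P) {i : Fin n} →
              ¬ P zero → rank P? (suc i) ≡ rank (P? ∘ suc) i
rank-suc-no P? ¬p with P? zero
... | yes p = contradiction p ¬p
... | no _  = refl

rank-surjective : ∀ {n} {P : Fin n → Set} (P? : Decidable P) {r : ℕ} →
                  r < count P? → ∃ λ i → P i × rank P? i ≡ r
rank-surjective {zero} P? ()
rank-surjective {suc n} P? r<count with P? zero
rank-surjective {suc n} P? {zero}  _             | yes p = zero , p , refl
rank-surjective {suc n} P? {suc r} (s≤s r<count) | yes p with rank-surjective (P? ∘ suc) r<count
... | i , pi , eq = suc i , pi , trans (rank-suc-yes P? {i} p) (cong suc eq)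
rank-surjective {suc n} P? r<count | no ¬p with rank-surjective (P? ∘ suc) r<count
... | i , pi , eq = suc i , pi , trans (rank-suc-no P? {i} ¬p) eq

length-filter-tabulate : ∀ {A : Set} {P : A → Set} (P? : Decidable P) {n} (f : Fin n → A) →
                         length (filter P? (tabulate f)) ≡ count (P? ∘ f)
length-filter-tabulate P? {zero}  f = refl
length-filter-tabulate P? {suc n} f with P? (f zero)
... | yes _ = cong suc (length-filter-tabulate P? (f ∘ suc))
... | no _  = length-filter-tabulate P? (f ∘ suc)

count-cong : ∀ {n} {P Q : Fin n → Set} (P? : Decidable P) (Q? : Decidable Q) →
             P ≐ Q → count P? ≡ count Q?
count-cong {zero}  P? Q? P≐Q = refl
count-cong {suc n} P? Q? (P⊆Q , Q⊆P) with P? zero | Q? zero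
... | yes _ | yes _ = cong suc (count-cong (P? ∘ suc) (Q? ∘ suc) (P⊆Q , Q⊆P))
... | no _  | no _  = count-cong (P? ∘ suc) (Q? ∘ suc) (P⊆Q , Q⊆P)
... | yes p | no ¬q = contradiction (P⊆Q p) ¬q
... | no ¬p | yes q = contradiction (Q⊆P q) ¬p

count-↑ˡ↑ʳ : ∀ m {n} {P : Fin (m + n) → Set} (P? : Decidable P) →
             count P? ≡ count (P? ∘ (_↑ˡ n)) + count (P? ∘ (m ↑ʳ_))
count-↑ˡ↑ʳ zero    P? = refl
count-↑ˡ↑ʳ (suc m) P? with P? zero
... | yes _ = cong suc (count-↑ˡ↑ʳ m (P? ∘ suc))
... | no _  = count-↑ˡ↑ʳ m (P? ∘ suc)

count-⊎ : ∀ {n} {P Q : Fin n → Set} (P? : Decidable P) (Q? : Decidable Q) →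
          (∀ {i} → P i → ¬ Q i) → count (λ i → P? i ⊎-dec Q? i) ≡ count P? + count Q?
count-⊎ {zero}  P? Q? disjoint = refl
count-⊎ {suc n} P? Q? disjoint with P? zero | Q? zero
... | yes p | yes q = contradiction q (disjoint p)
... | yes _ | no _  = cong suc (count-⊎ (P? ∘ suc) (Q? ∘ suc) disjoint)
... | no _  | yes _ = trans (cong suc (count-⊎ (P? ∘ suc) (Q? ∘ suc) disjoint))
                           (sym (+-suc (count (P? ∘ suc)) (count (Q? ∘ suc))))
... | no _  | no _  = count-⊎ (P? ∘ suc) (Q? ∘ suc) disjoint

count-∅ : ∀ {n} {P : Fin n → Set} (P? : Decidable P) → (∀ i → ¬ P i) → count P? ≡ 0
count-∅ {zero}  P? ¬P = refl
count-∅ {suc n} P? ¬P with P? zero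
... | yes p = contradiction p (¬P zero)
... | no _  = count-∅ (P? ∘ suc) (¬P ∘ suc)

count-≡ : ∀ {n} (i : Fin n) → count (_≟ i) ≡ 1
count-≡ {suc n} zero = cong suc (count-∅ {n} (λ j → suc j ≟ zero) λ _ ())
count-≡ {suc n} (suc i) = trans (count-cong (λ j → suc j ≟ suc i) (_≟ i) (suc-injective , cong suc)) (count-≡ i)

injective⇒surjective : ∀ {k} {f : Fin k → Fin k} → Injective _≡_ _≡_ f → ∀ y → ∃ λ x → f x ≡ y
injective⇒surjective {suc k} {f} f-injective y with any? (λ x → f x ≟ y)
... | yes found = found
... | no ¬found = contradiction (injective⇒≤ punched-injective) 1+n≰n
  where
    misses : ∀ x → y ≢ f x
    misses x eq = ¬found (x , sym eq)
    punched-injective : Injective _≡_ _≡_ (λ x → punchOut (misses x))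
    punched-injective {x} {x'} eq = f-injective (punchOut-injective (misses x) (misses x') eq)

-- Bipartite edge colouring

Proper : ∀ {A X C : Set} → (A → X) → (A → C) → Set
Proper end col = ∀ e e' → end e ≡ end e' → col e ≡ col e' → e ≡ e'

proper-∘ : ∀ {A B X C : Set} {end : A → X} {col : A → C} {f : B → A} →
           Injective _≡_ _≡_ f → Proper end col → Proper (end ∘ f) (col ∘ f)
proper-∘ f-injective col-proper e e' ends cols = f-injective (col-proper _ _ ends cols)

proper-cong : ∀ {A X C : Set} {end end' : A → X} {col : A → C} →
              (∀ e → end e ≡ end' e) → Proper end col → Proper end' col
proper-cong end≗end' col-proper e e' ends cols =
  col-proper e e' (trans (end≗end' e) (trans ends (sym (end≗end' e')))) cols

Saturated : ∀ {A X C : Set} → (A → X) → (A → C) → X → Set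
Saturated end col x = ∀ c → ∃ λ e → end e ≡ x × col e ≡ c

saturated-transfer : ∀ {A X : Set} {k} {end : A → X} {σ β : A → Fin k} {x : X} →
                     Proper end σ → Proper end β → Saturated end σ x → Saturated end β x
saturated-transfer {A} {k = k} {end} {σ} {β} {x} σ-proper β-proper σ-saturated c =
  let j , β-edge≡c = injective⇒surjective β∘edge-injective c in edge j , edge-at-x j , β-edge≡c
  where
    edge : Fin k → A
    edge j = proj₁ (σ-saturated j)
    edge-at-x : ∀ j → end (edge j) ≡ x
    edge-at-x j = proj₁ (proj₂ (σ-saturated j))
    σ-edge : ∀ j → σ (edge j) ≡ j
    σ-edge j = proj₂ (proj₂ (σ-saturated j))
    β∘edge-injective : Injective _≡_ _≡_ (β ∘ edge)
    β∘edge-injective {j} {j'} eq =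
      trans (sym (σ-edge j)) (trans (cong σ (β-proper _ _ (trans (edge-at-x j) (sym (edge-at-x j'))) eq)) (σ-edge j'))

module Reachability {m : ℕ} {R : Fin m → Fin m → Set} (R? : ∀ x y → Dec (R x y)) where

  -- Warshall's algorithm: Path k x y is a path whose intermediate vertices all have index below k.
  Path : ℕ → Fin m → Fin m → Set
  Path zero    x y = x ≡ y ⊎ R x y
  Path (suc k) x y = Path k x y ⊎ ∃ λ j → toℕ j ≡ k × Path k x j × Path k j y

  path? : ∀ k x y → Dec (Path k x y)
  path? zero    x y = (x ≟ y) ⊎-dec R? x y
  path? (suc k) x y = path? k x y ⊎-dec any? (λ j → (toℕ j ℕ.≟ k) ×-dec (path? k x j ×-dec path? k j y))

  path-lift : ∀ k {x y} → Path zero x y → Path k x y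
  path-lift zero    p = p
  path-lift (suc k) p = inj₁ (path-lift k p)

  private
    into-pivot : ∀ {k x y} → toℕ y ≡ k → Path (suc k) x y → Path k x y
    into-pivot y≡k (inj₁ p)                  = p
    into-pivot y≡k (inj₂ (j , j≡k , p , _)) = subst (Path _ _) (toℕ-injective (trans j≡k (sym y≡k))) p

    out-of-pivot : ∀ {k y z} → toℕ y ≡ k → Path (suc k) y z → Path k y z
    out-of-pivot y≡k (inj₁ q)                  = q
    out-of-pivot y≡k (inj₂ (j , j≡k , _ , q)) = subst (λ j → Path _ j _) (toℕ-injective (trans j≡k (sym y≡k))) q

  path-trans : ∀ k {x y z} → toℕ y < k → Path k x y → Path k y z → Path k x z
  path-trans (suc k) {x} {y} {z} y<1+k p q with m<1+n⇒m<n∨m≡n y<1+k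
  ... | inj₂ y≡k = inj₂ (y , y≡k , into-pivot y≡k p , out-of-pivot y≡k q)
  ... | inj₁ y<k = concat p q
    where
      concat : Path (suc k) x y → Path (suc k) y z → Path (suc k) x z
      concat (inj₁ p)                    (inj₁ q)                   = inj₁ (path-trans k y<k p q)
      concat (inj₁ p)                    (inj₂ (j , j≡k , q₁ , q₂)) = inj₂ (j , j≡k , path-trans k y<k p q₁ , q₂)
      concat (inj₂ (j , j≡k , p₁ , p₂)) (inj₁ q)                   = inj₂ (j , j≡k , p₁ , path-trans k y<k p₂ q)
      concat (inj₂ (j , j≡k , p₁ , _))  (inj₂ (j' , j'≡k , _ , q₂)) =
        inj₂ (j , j≡k , p₁ , subst (λ j → Path k j z) (toℕ-injective (trans j'≡k (sym j≡k))) q₂)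

  path-ind : (P : Fin m → Set) → (∀ {x y} → R x y → P x → P y) → ∀ k {x y} → Path k x y → P x → P y
  path-ind P step zero    (inj₁ refl)              px = px
  path-ind P step zero    (inj₂ r)                 px = step r px
  path-ind P step (suc k) (inj₁ p)                 px = path-ind P step k p px
  path-ind P step (suc k) (inj₂ (_ , _ , p , q)) px = path-ind P step k q (path-ind P step k p px)

  Reachable : Fin m → Fin m → Set
  Reachable = Path m

  reachable? : ∀ x y → Dec (Reachable x y)
  reachable? = path? m

  reachable-refl : ∀ {x} → Reachable x x
  reachable-refl = path-lift m (inj₁ refl)

  reachable-step : ∀ {x y z} → Reachable x y → R y z → Reachable x z
  reachable-step {y = y} p r = path-trans m (toℕ<n y) p (path-lift m (inj₂ r))

  reachable-ind : (P : Fin m → Set) → (∀ {x y} → R x y → P x → P y) → ∀ {x y} → Reachable x y → P x → P y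
  reachable-ind P step = path-ind P step m

Missing : ∀ {A X C : Set} → (A → X) → (A → C) → X → C → Set
Missing end col x c = ∀ e → end e ≡ x → col e ≢ c

missing-colour : ∀ {X : Set} {m k} (_≟X_ : DecidableEquality X) (end : Fin (suc m) → X) {σ : Fin (suc m) → Fin k} →
                 Proper end σ → (c : Fin m → Fin k) → ∃ (Missing (end ∘′ suc) c (end zero))
missing-colour {m = m} {k} _≟X_ end {σ} σ-proper c = from-decision (all? used?)
  where
    Used : Fin k → Set
    Used a = ∃ λ i → end (suc i) ≡ end zero × c i ≡ a
    used? : ∀ a → Dec (Used a)
    used? a = any? λ i → (end (suc i) ≟X end zero) ×-dec (c i ≟ a)
    from-decision : Dec (∀ a → Used a) → ∃ (Missing (end ∘′ suc) c (end zero))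
    from-decision (no ¬all-used) =
      let a , unused = ¬∀⟶∃¬ k Used used? ¬all-used in a , λ i at c≡a → unused (i , at , c≡a)
    -- Otherwise the k colours used at end zero by the other edges would, together with edge zero, carry k + 1 values of σ.
    from-decision (yes all-used) =
      let a , σ-user≡σ0 = injective⇒surjective σ∘user-injective (σ zero)
      in contradiction (σ-proper (user a) zero (user-at a) σ-user≡σ0) λ ()
      where
        user : Fin k → Fin (suc m)
        user a = suc (proj₁ (all-used a))
        user-at : ∀ a → end (user a) ≡ end zero
        user-at a = proj₁ (proj₂ (all-used a))
        σ∘user-injective : ∀ {a a'} → σ (user a) ≡ σ (user a') → a ≡ a'
        σ∘user-injective {a} {a'} eq =
          trans (sym (proj₂ (proj₂ (all-used a))))
                (trans (cong c (suc-injective (σ-proper _ _ (trans (user-at a) (sym (user-at a'))) eq)))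
                       (proj₂ (proj₂ (all-used a'))))

extend-proper : ∀ {X : Set} {m k} (end : Fin (suc m) → X) {c : Fin m → Fin k} {a : Fin k} →
                Proper (end ∘′ suc) c → Missing (end ∘′ suc) c (end zero) a → Proper end (a ∷ c)
extend-proper end c-proper a-missing zero    zero     _  _  = refl
extend-proper end c-proper a-missing zero    (suc i) at eq = contradiction (sym eq) (a-missing i (sym at))
extend-proper end c-proper a-missing (suc i) zero    at eq = contradiction eq (a-missing i at)
extend-proper end c-proper a-missing (suc i) (suc j) at eq = cong suc (c-proper i j at eq)

splitAt-injective : ∀ m {n} {x y : Fin (m + n)} → splitAt m x ≡ splitAt m y → x ≡ y
splitAt-injective m {n} {x} {y} eq = trans (sym (join-splitAt m n x)) (trans (cong (join m n) eq) (join-splitAt m n y))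

join-injective : ∀ m n {x y : Fin m ⊎ Fin n} → join m n x ≡ join m n y → x ≡ y
join-injective m n {x} {y} eq = trans (sym (splitAt-join m n x)) (trans (cong (splitAt m) eq) (splitAt-join m n y))

-- A bipartite multigraph is given by its edges Fin m with their left ends l : Fin m → L and right ends r : Fin m → R.
module Bipartite {L R : Set} (_≟L_ : DecidableEquality L) (_≟R_ : DecidableEquality R) {k : ℕ} where

  -- Swapping the colours a and b along the a/b-alternating path that starts at w with the a-edge ea frees a at w;
  -- by parity that path can reach u only through an a-edge, so a stays free at u.
  module KempeChain {m} (l : Fin m → L) (r : Fin m → R) {c : Fin m → Fin k}
                    (l-proper : Proper l c) (r-proper : Proper r c)
                    {a b : Fin k} (a≢b : a ≢ b) {w : R} {ea : Fin m} (ea-at-w : r ea ≡ w) (ea-a : c ea ≡ a)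
                    (b-missing-at-w : Missing r c w b) {u : L} (a-missing-at-u : Missing l c u a) where

    SharesEnd : Fin m → Fin m → Set
    SharesEnd f g = l f ≡ l g ⊎ r f ≡ r g

    AB : Fin m → Set
    AB f = c f ≡ a ⊎ c f ≡ b

    Next : Fin m → Fin m → Set
    Next f g = (c f ≡ a × c g ≡ b × l f ≡ l g) ⊎ (c f ≡ b × c g ≡ a × r f ≡ r g)

    next? : ∀ f g → Dec (Next f g)
    next? f g = ((c f ≟ a) ×-dec ((c g ≟ b) ×-dec (l f ≟L l g)))
         ⊎-dec ((c f ≟ b) ×-dec ((c g ≟ a) ×-dec (r f ≟R r g)))

    open Reachability next?

    InChain : Fin m → Set
    InChain = Reachable ea

    chain-colour : ∀ {f} → InChain f → AB f
    chain-colour f∈ = reachable-ind AB next-colour f∈ (inj₁ ea-a)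
      where
        next-colour : ∀ {f g} → Next f g → AB f → AB g
        next-colour (inj₁ (_ , g-b , _)) _ = inj₂ g-b
        next-colour (inj₂ (_ , g-a , _)) _ = inj₁ g-a

    chain-entry : ∀ {f} → InChain f → f ≡ ea ⊎ ∃ λ f' → InChain f' × Next f' f
    chain-entry f∈ = proj₂ (reachable-ind Entered next-entered f∈ (reachable-refl , inj₁ refl))
      where
        Entered : Fin m → Set
        Entered g = InChain g × (g ≡ ea ⊎ ∃ λ f' → InChain f' × Next f' g)
        next-entered : ∀ {f g} → Next f g → Entered f → Entered g
        next-entered {f} step (f∈ , _) = reachable-step f∈ step , inj₂ (f , f∈ , step)

    a-edge-predecessor : ∀ {f} → InChain f → c f ≡ a → f ≡ ea ⊎ ∃ λ f' → InChain f' × c f' ≡ b × r f' ≡ r f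
    a-edge-predecessor f∈ f-a with chain-entry f∈
    ... | inj₁ f≡ea                              = inj₁ f≡ea
    ... | inj₂ (f' , f'∈ , inj₁ (_ , f-b , _))   = contradiction (trans (sym f-a) f-b) a≢b
    ... | inj₂ (f' , f'∈ , inj₂ (f'-b , _ , rr)) = inj₂ (f' , f'∈ , f'-b , rr)

    b-edge-predecessor : ∀ {f} → InChain f → c f ≡ b → ∃ λ f' → InChain f' × c f' ≡ a × l f' ≡ l f
    b-edge-predecessor f∈ f-b with chain-entry f∈
    ... | inj₁ refl                              = contradiction (trans (sym ea-a) f-b) a≢b
    ... | inj₂ (f' , f'∈ , inj₁ (f'-a , _ , ll)) = f' , f'∈ , f'-a , ll
    ... | inj₂ (f' , f'∈ , inj₂ (_ , f-a , _))   = contradiction (trans (sym f-a) f-b) a≢b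

    same-colour-at-shared-end : ∀ {f g} → SharesEnd f g → c f ≡ c g → f ≡ g
    same-colour-at-shared-end (inj₁ ll) = l-proper _ _ ll
    same-colour-at-shared-end (inj₂ rr) = r-proper _ _ rr

    chain-closed : ∀ {f g} → InChain f → g ≢ f → AB g → SharesEnd f g → InChain g
    chain-closed {f} {g} f∈ g≢f g-ab shared with chain-colour f∈ | g-ab | shared
    ... | inj₁ f-a | inj₁ g-a | _ = contradiction (sym (same-colour-at-shared-end shared (trans f-a (sym g-a)))) g≢f
    ... | inj₂ f-b | inj₂ g-b | _ = contradiction (sym (same-colour-at-shared-end shared (trans f-b (sym g-b)))) g≢f
    ... | inj₁ f-a | inj₂ g-b | inj₁ ll = reachable-step f∈ (inj₁ (f-a , g-b , ll))
    ... | inj₂ f-b | inj₁ g-a | inj₂ rr = reachable-step f∈ (inj₂ (f-b , g-a , rr))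
    ... | inj₁ f-a | inj₂ g-b | inj₂ rr with a-edge-predecessor f∈ f-a
    ...   | inj₁ refl = contradiction g-b (b-missing-at-w g (trans (sym rr) ea-at-w))
    ...   | inj₂ (f' , f'∈ , f'-b , rr') = subst InChain (r-proper f' g (trans rr' rr) (trans f'-b (sym g-b))) f'∈
    chain-closed {f} {g} f∈ g≢f g-ab shared | inj₂ f-b | inj₁ g-a | inj₁ ll with b-edge-predecessor f∈ f-b
    ... | f' , f'∈ , f'-a , ll' = subst InChain (l-proper f' g (trans ll' ll) (trans f'-a (sym g-a))) f'∈

    recolour : Fin m → Fin k
    recolour f with reachable? ea f | c f ≟ a
    ... | yes _ | yes _ = b
    ... | yes _ | no _  = a
    ... | no _  | _     = c f

    recolour-a : ∀ {f} → InChain f → c f ≡ a → recolour f ≡ b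
    recolour-a {f} f∈ f-a with reachable? ea f | c f ≟ a
    ... | yes _ | yes _   = refl
    ... | yes _ | no f≢a  = contradiction f-a f≢a
    ... | no f∉ | _       = contradiction f∈ f∉

    recolour-b : ∀ {f} → InChain f → c f ≡ b → recolour f ≡ a
    recolour-b {f} f∈ f-b with reachable? ea f | c f ≟ a
    ... | yes _ | yes f-a = contradiction (trans (sym f-a) f-b) a≢b
    ... | yes _ | no _    = refl
    ... | no f∉ | _       = contradiction f∈ f∉

    recolour-outside : ∀ {f} → ¬ InChain f → recolour f ≡ c f
    recolour-outside {f} f∉ with reachable? ea f | c f ≟ a
    ... | yes f∈ | _ = contradiction f∈ f∉
    ... | no _   | _ = refl

    recolour-chain : ∀ {f} → InChain f → recolour f ≡ a ⊎ recolour f ≡ b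
    recolour-chain f∈ with chain-colour f∈
    ... | inj₁ f-a = inj₂ (recolour-a f∈ f-a)
    ... | inj₂ f-b = inj₁ (recolour-b f∈ f-b)

    chain-boundary : ∀ {f g} → InChain f → ¬ InChain g → SharesEnd f g → recolour f ≢ recolour g
    chain-boundary {f} {g} f∈ g∉ shared eq = g∉ (chain-closed f∈ g≢f g-ab shared)
      where
        g≢f : g ≢ f
        g≢f refl = g∉ f∈
        g-ab : AB g
        g-ab with recolour-chain f∈
        ... | inj₁ f-a = inj₁ (trans (sym (recolour-outside g∉)) (trans (sym eq) f-a))
        ... | inj₂ f-b = inj₂ (trans (sym (recolour-outside g∉)) (trans (sym eq) f-b))

    recolour-reflects : ∀ {f g} → SharesEnd f g → recolour f ≡ recolour g → c f ≡ c g
    recolour-reflects {f} {g} shared eq with toSum (reachable? ea f) | toSum (reachable? ea g)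
    ... | inj₁ f∈ | inj₂ g∉ = contradiction eq (chain-boundary f∈ g∉ shared)
    ... | inj₂ f∉ | inj₁ g∈ = contradiction (sym eq) (chain-boundary g∈ f∉ (flip shared))
      where
        flip : SharesEnd f g → SharesEnd g f
        flip (inj₁ ll) = inj₁ (sym ll)
        flip (inj₂ rr) = inj₂ (sym rr)
    ... | inj₂ f∉ | inj₂ g∉ = trans (sym (recolour-outside f∉)) (trans eq (recolour-outside g∉))
    ... | inj₁ f∈ | inj₁ g∈ with chain-colour f∈ | chain-colour g∈
    ...   | inj₁ f-a | inj₁ g-a = trans f-a (sym g-a)
    ...   | inj₂ f-b | inj₂ g-b = trans f-b (sym g-b)
    ...   | inj₁ f-a | inj₂ g-b = contradiction (trans (sym (recolour-b g∈ g-b)) (trans (sym eq) (recolour-a f∈ f-a))) a≢b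
    ...   | inj₂ f-b | inj₁ g-a = contradiction (trans (sym (recolour-b f∈ f-b)) (trans eq (recolour-a g∈ g-a))) a≢b

    recolour-proper-l : Proper l recolour
    recolour-proper-l f g ll eq = l-proper f g ll (recolour-reflects (inj₁ ll) eq)

    recolour-proper-r : Proper r recolour
    recolour-proper-r f g rr eq = r-proper f g rr (recolour-reflects (inj₂ rr) eq)

    recolour-missing-at-w : Missing r recolour w a
    recolour-missing-at-w f f-at-w eq with toSum (reachable? ea f)
    ... | inj₂ f∉ = f∉ (subst InChain (sym (r-proper f ea (trans f-at-w (sym ea-at-w))
                                                      (trans (sym (recolour-outside f∉)) (trans eq (sym ea-a)))))
                                   reachable-refl)
    ... | inj₁ f∈ with chain-colour f∈
    ...   | inj₁ f-a = a≢b (trans (sym eq) (recolour-a f∈ f-a))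
    ...   | inj₂ f-b = b-missing-at-w f f-at-w f-b

    recolour-missing-at-u : Missing l recolour u a
    recolour-missing-at-u f f-at-u eq with toSum (reachable? ea f)
    ... | inj₂ f∉ = a-missing-at-u f f-at-u (trans (sym (recolour-outside f∉)) eq)
    ... | inj₁ f∈ with chain-colour f∈
    ...   | inj₁ f-a = a-missing-at-u f f-at-u f-a
    ...   | inj₂ f-b with b-edge-predecessor f∈ f-b
    ...     | f' , _ , f'-a , ll = a-missing-at-u f' (trans ll f-at-u) f'-a

  common-missing-colour : ∀ {m} (l : Fin m → L) (r : Fin m → R) {c : Fin m → Fin k} → Proper l c → Proper r c →
                          ∀ {a b u w} → Missing l c u a → Missing r c w b →
                          ∃ λ (c' : Fin m → Fin k) → (Proper l c' × Proper r c') × (Missing l c' u a × Missing r c' w a)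
  common-missing-colour l r {c} l-proper r-proper {a} {b} {u} {w} a-missing-at-u b-missing-at-w
    with any? (λ e → (r e ≟R w) ×-dec (c e ≟ a))
  ... | no ¬a-at-w = c , (l-proper , r-proper) , a-missing-at-u , λ e at eq → ¬a-at-w (e , at , eq)
  ... | yes (ea , ea-at-w , ea-a) =
    recolour , (recolour-proper-l , recolour-proper-r) , recolour-missing-at-u , recolour-missing-at-w
    where
      a≢b : a ≢ b
      a≢b a≡b = b-missing-at-w ea ea-at-w (trans ea-a a≡b)
      open KempeChain l r l-proper r-proper a≢b ea-at-w ea-a b-missing-at-w a-missing-at-u

  -- König's line colouring theorem: if every vertex has at most k incident edges (witnessed by the colourings σ and τ
  -- that are proper on the left and on the right respectively), the edges have a k-colouring proper on both sides.
  edge-colouring : ∀ {m} (l : Fin m → L) (r : Fin m → R) {σ τ : Fin m → Fin k} →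
                   Proper l σ → Proper r τ → ∃ λ (c : Fin m → Fin k) → Proper l c × Proper r c
  edge-colouring {zero}  l r σ-proper τ-proper = (λ ()) , (λ ()) , (λ ())
  edge-colouring {suc m} l r {σ} {τ} σ-proper τ-proper
    with edge-colouring (l ∘′ suc) (r ∘′ suc) {σ ∘′ suc} {τ ∘′ suc} (proper-∘ suc-injective σ-proper)
                                                                    (proper-∘ suc-injective τ-proper)
  ... | c , c-proper-l , c-proper-r
    with missing-colour _≟L_ l σ-proper c | missing-colour _≟R_ r τ-proper c
  ... | a , a-missing-at-u | b , b-missing-at-w
    with common-missing-colour (l ∘′ suc) (r ∘′ suc) c-proper-l c-proper-r a-missing-at-u b-missing-at-w
  ... | c' , (c'-proper-l , c'-proper-r) , a-missing-at-u' , a-missing-at-w' =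
    a ∷ c' , extend-proper l c'-proper-l a-missing-at-u' , extend-proper r c'-proper-r a-missing-at-w'

  edge-colouring-⊎ : ∀ {m n} (l : Fin m ⊎ Fin n → L) (r : Fin m ⊎ Fin n → R) {σ τ : Fin m ⊎ Fin n → Fin k} →
                     Proper l σ → Proper r τ → ∃ λ (c : Fin m ⊎ Fin n → Fin k) → Proper l c × Proper r c
  edge-colouring-⊎ {m} {n} l r σ-proper τ-proper
    with edge-colouring (l ∘′ splitAt m) (r ∘′ splitAt m) (proper-∘ (splitAt-injective m) σ-proper)
                                                          (proper-∘ (splitAt-injective m) τ-proper)
  ... | c , c-proper-l , c-proper-r =
    c ∘′ join m n , proper-cong (cong l ∘ splitAt-join m n) (proper-∘ (join-injective m n) c-proper-l)
                  , proper-cong (cong r ∘ splitAt-join m n) (proper-∘ (join-injective m n) c-proper-r)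

maxDegree-lub : ∀ G {b} → (∀ v → degree G v ≤ b) → maxDegree G ≤ b
maxDegree-lub G {b} degree≤b = foldr-preservesᵇ {P = _≤ b} {f = _⊔_} ⊔-lub z≤n (map⁺ (tabulate⁺ degree≤b))

degree≤maxDegree : ∀ G v → degree G v ≤ maxDegree G
degree≤maxDegree G = tabulate⁻ (map⁻ (foldr-forcesᵇ {P = _≤ maxDegree G} {f = _⊔_} split 0 _ ≤-refl))
  where
    split : ∀ m n → m ⊔ n ≤ maxDegree G → m ≤ maxDegree G × n ≤ maxDegree G
    split m n m⊔n≤ = m⊔n≤o⇒m≤o m n m⊔n≤ , m⊔n≤o⇒n≤o m n m⊔n≤

minDegree≤degree : ∀ G v → minDegree G ≤ degree G v
minDegree≤degree G = tabulate⁻ (map⁻ (foldr-forcesᵇ {P = minDegree G ≤_} {f = _⊓_} split (maxDegree G) _ ≤-refl))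
  where
    split : ∀ m n → minDegree G ≤ m ⊓ n → minDegree G ≤ m × minDegree G ≤ n
    split m n ≤m⊓n = m≤n⊓o⇒m≤n m n ≤m⊓n , m≤n⊓o⇒m≤o m n ≤m⊓n

-- The colours 1, …, K * 2 are the pairs (c , s), read as 2c + s + 1.
opaque
  colour : ∀ {K} → Fin K → Fin 2 → ℕ
  colour c s = suc (toℕ (combine c s))

  colour-injective : ∀ {K} {c c' : Fin K} {s s'} → colour c s ≡ colour c' s' → c ≡ c' × s ≡ s'
  colour-injective {c = c} {c'} {s} {s'} eq = combine-injective c s c' s' (toℕ-injective (ℕ.suc-injective eq))

  1≤colour : ∀ {K} (c : Fin K) s → 1 ≤ colour c s
  1≤colour c s = s≤s z≤n

  colour≤ : ∀ {K} (c : Fin K) s → colour c s ≤ K * 2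
  colour≤ c s = toℕ<n (combine c s)

  colour-surjective : ∀ {K n} → 1 ≤ n → n ≤ K * 2 → ∃₂ λ (c : Fin K) s → colour c s ≡ n
  colour-surjective {n = suc n} (s≤s z≤n) n<K*2 =
    let c , s , eq = combine-surjective (fromℕ< n<K*2) in c , s , cong suc (trans (cong toℕ eq) (toℕ-fromℕ< n<K*2))

  colour-suc : ∀ {K} (c : Fin K) → colour c (suc zero) ≡ suc (colour c zero)
  colour-suc c = cong suc (trans (toℕ-combine c (suc zero))
                         (trans (+-suc (2 * toℕ c) 0) (cong suc (sym (toℕ-combine c zero)))))

colour-pair : ∀ {K} (c : Fin K) s → colour c s ≡ colour c zero ⊎ colour c s ≡ suc (colour c zero)
colour-pair c zero       = inj₁ refl
colour-pair c (suc zero) = inj₂ (colour-suc c)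

maxDegree≤spread+degree : ∀ G v → maxDegree G ≤ (maxDegree G ∸ minDegree G) + degree G v
maxDegree≤spread+degree G v = begin
  maxDegree G                                ≤⟨ m≤n+m∸n (maxDegree G) (minDegree G) ⟩
  minDegree G + (maxDegree G ∸ minDegree G)  ≤⟨ +-monoˡ-≤ _ (minDegree≤degree G v) ⟩
  degree G v + (maxDegree G ∸ minDegree G)   ≡⟨ +-comm (degree G v) _ ⟩
  (maxDegree G ∸ minDegree G) + degree G v   ∎
  where open ≤-Reasoning

∅-consecutive : ∀ {X : ℕ → Set} → (∀ c → ¬ X c) → Consecutive X
∅-consecutive ¬X = 1 , 0 , λ c → (λ x → contradiction x (¬X c))
                                , λ { (1≤c , c≤0) → contradiction (≤-trans 1≤c c≤0) λ () }

singleton-consecutive : ∀ {X : ℕ → Set} {n} → X n → (∀ c → X c → c ≡ n) → Consecutive X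
singleton-consecutive {X} {n} xn only-n =
  n , n , λ c → (λ x → ≤-reflexive (sym (only-n c x)) , ≤-reflexive (only-n c x))
              , λ (n≤c , c≤n) → subst X (≤-antisym n≤c c≤n) xn

pair-consecutive : ∀ {X : ℕ → Set} {n} → Decidable X → (∀ c → X c → c ≡ n ⊎ c ≡ suc n) → Consecutive X
pair-consecutive {X} {n} X? ⊆pair with X? n | X? (suc n)
... | yes xn | yes xn+1 = n , suc n , λ c → bounds c , members c
  where
    bounds : ∀ c → X c → n ≤ c × c ≤ suc n
    bounds c x with ⊆pair c x
    ... | inj₁ refl = ≤-refl , n≤1+n n
    ... | inj₂ refl = n≤1+n n , ≤-refl
    members : ∀ c → n ≤ c × c ≤ suc n → X c
    members c (n≤c , c≤n+1) with m≤n⇒m<n∨m≡n n≤c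
    ... | inj₁ n<c = subst X (≤-antisym n<c c≤n+1) xn+1
    ... | inj₂ n≡c = subst X n≡c xn
... | yes xn | no ¬xn+1 =
  singleton-consecutive xn λ c x → [ id , (λ c≡n+1 → contradiction (subst X c≡n+1 x) ¬xn+1) ] (⊆pair c x)
... | no ¬xn | yes xn+1 =
  singleton-consecutive xn+1 λ c x → [ (λ c≡n → contradiction (subst X c≡n x) ¬xn) , id ] (⊆pair c x)
... | no ¬xn | no ¬xn+1 =
  ∅-consecutive λ c x → [ (λ c≡n → ¬xn (subst X c≡n x)) , (λ c≡n+1 → ¬xn+1 (subst X c≡n+1 x)) ] (⊆pair c x)

↑ˡ≢↑ʳ : ∀ {m n} (i : Fin m) (j : Fin n) → i ↑ˡ n ≢ m ↑ʳ j
↑ˡ≢↑ʳ {m} {n} i j eq with trans (sym (splitAt-↑ˡ m i n)) (trans (cong (splitAt m) eq) (splitAt-↑ʳ m n j))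
... | ()

↑-view : ∀ m {n} (x : Fin (m + n)) → (∃ λ i → i ↑ˡ n ≡ x) ⊎ (∃ λ j → m ↑ʳ j ≡ x)
↑-view m x with splitAt m x in eq
... | inj₁ i = inj₁ (i , splitAt⁻¹-↑ˡ eq)
... | inj₂ j = inj₂ (j , splitAt⁻¹-↑ʳ eq)

degree≡count : ∀ G v → degree G v ≡ count (incident? G v)
degree≡count G v = length-filter-tabulate (incident? G v) id

degree-positive : ∀ G {v e} → Incident G v e → 1 ≤ degree G v
degree-positive G {v} inc = subst (1 ≤_) (sym (degree≡count G v)) (≤-trans (s≤s z≤n) (rank<count (incident? G v) inc))

maxDegree≡0⇒edgeless : ∀ G → maxDegree G ≡ 0 → ¬ Fin (E G)
maxDegree≡0⇒edgeless G max≡0 e =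
  contradiction (subst (1 ≤_) max≡0 (≤-trans (degree-positive G {e = e} (inj₁ refl)) (degree≤maxDegree G _))) λ ()

-- The full subdivision

-- The edges of the full subdivision are the darts (half-edges) of H: dart e ↑ˡ E H joins the first end of e to the
-- subdivision vertex of e, and dart E H ↑ʳ e joins that vertex to the second end.
module Darts (H : Graph) where

  G : Graph
  G = fullSubdivision H

  Dart : Set
  Dart = Fin (E H + E H)

  dartEnd : Dart → Fin (V H)
  dartEnd h = [ proj₁ ∘ ends H , proj₂ ∘ ends H ]′ (splitAt (E H) h)

  dartEdge : Dart → Fin (E H)
  dartEdge h = reduce (splitAt (E H) h)

  dartSide : Dart → Fin 2
  dartSide h = [ const zero , const (suc zero) ]′ (splitAt (E H) h)

  dartEnd-↑ˡ : ∀ e → dartEnd (e ↑ˡ E H) ≡ proj₁ (ends H e)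
  dartEnd-↑ˡ e rewrite splitAt-↑ˡ (E H) e (E H) = refl

  dartEnd-↑ʳ : ∀ e → dartEnd (E H ↑ʳ e) ≡ proj₂ (ends H e)
  dartEnd-↑ʳ e rewrite splitAt-↑ʳ (E H) (E H) e = refl

  dartEdge-↑ˡ : ∀ e → dartEdge (e ↑ˡ E H) ≡ e
  dartEdge-↑ˡ e rewrite splitAt-↑ˡ (E H) e (E H) = refl

  dartEdge-↑ʳ : ∀ e → dartEdge (E H ↑ʳ e) ≡ e
  dartEdge-↑ʳ e rewrite splitAt-↑ʳ (E H) (E H) e = refl

  dartSide-↑ˡ : ∀ e → dartSide (e ↑ˡ E H) ≡ zero
  dartSide-↑ˡ e rewrite splitAt-↑ˡ (E H) e (E H) = refl

  dartSide-↑ʳ : ∀ e → dartSide (E H ↑ʳ e) ≡ suc zero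
  dartSide-↑ʳ e rewrite splitAt-↑ʳ (E H) (E H) e = refl

  dartSide-proper : Proper dartEdge dartSide
  dartSide-proper h h' same-edge same-side =
    splitAt-injective (E H) (edge-side-injective (splitAt (E H) h) (splitAt (E H) h') same-edge same-side)
    where
      edge-side-injective : ∀ x y → reduce x ≡ reduce y →
                            [ const zero , const (suc zero) ]′ x ≡ [ const zero , const (suc zero) ]′ y → x ≡ y
      edge-side-injective (inj₁ e) (inj₁ e') same _  = cong inj₁ same
      edge-side-injective (inj₂ e) (inj₂ e') same _  = cong inj₂ same
      edge-side-injective (inj₁ e) (inj₂ e') _    ()
      edge-side-injective (inj₂ e) (inj₁ e') _    ()

  dartSide-saturated : ∀ e → Saturated dartEdge dartSide e
  dartSide-saturated e zero       = e ↑ˡ E H , dartEdge-↑ˡ e , dartSide-↑ˡ e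
  dartSide-saturated e (suc zero) = E H ↑ʳ e , dartEdge-↑ʳ e , dartSide-↑ʳ e

  incident-subdivision : ∀ x h → Incident G x h → dartEnd h ↑ˡ E H ≡ x ⊎ V H ↑ʳ dartEdge h ≡ x
  incident-subdivision x h inc with splitAt (E H) h
  incident-subdivision x h (inj₁ p) | inj₁ e = inj₁ p
  incident-subdivision x h (inj₂ p) | inj₁ e = inj₂ p
  incident-subdivision x h (inj₁ p) | inj₂ e = inj₂ p
  incident-subdivision x h (inj₂ p) | inj₂ e = inj₁ p

  subdivision-incident : ∀ x h → dartEnd h ↑ˡ E H ≡ x ⊎ V H ↑ʳ dartEdge h ≡ x → Incident G x h
  subdivision-incident x h inc with splitAt (E H) h
  subdivision-incident x h (inj₁ p) | inj₁ e = inj₁ p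
  subdivision-incident x h (inj₂ p) | inj₁ e = inj₂ p
  subdivision-incident x h (inj₁ p) | inj₂ e = inj₂ p
  subdivision-incident x h (inj₂ p) | inj₂ e = inj₁ p

  incident-branch : ∀ v → Incident G (v ↑ˡ E H) ≐ λ h → dartEnd h ≡ v
  incident-branch v = to , λ {h} at-v → subdivision-incident _ h (inj₁ (cong (_↑ˡ E H) at-v))
    where
      to : ∀ {h} → Incident G (v ↑ˡ E H) h → dartEnd h ≡ v
      to {h} inc with incident-subdivision _ h inc
      ... | inj₁ eq = ↑ˡ-injective (E H) _ _ eq
      ... | inj₂ eq = contradiction (sym eq) (↑ˡ≢↑ʳ v (dartEdge h))

  incident-subdivider : ∀ e → Incident G (V H ↑ʳ e) ≐ λ h → dartEdge h ≡ e
  incident-subdivider e = to , λ {h} of-e → subdivision-incident _ h (inj₂ (cong (V H ↑ʳ_) of-e))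
    where
      to : ∀ {h} → Incident G (V H ↑ʳ e) h → dartEdge h ≡ e
      to {h} inc with incident-subdivision _ h inc
      ... | inj₁ eq = contradiction eq (↑ˡ≢↑ʳ (dartEnd h) e)
      ... | inj₂ eq = ↑ʳ-injective (V H) _ _ eq

  at? : ∀ v → Decidable (λ h → dartEnd h ≡ v)
  at? v h = dartEnd h ≟ v

  degree-darts : ∀ v → degree H v ≡ count (at? v)
  degree-darts v = begin
    degree H v                                                 ≡⟨ degree≡count H v ⟩
    count (incident? H v)                                      ≡⟨ count-⊎ first? second? not-both ⟩
    count first? + count second?                               ≡⟨ cong₂ _+_ (count-cong first? _ first-ends)
                                                                            (count-cong second? _ second-ends) ⟩
    count (at? v ∘ (_↑ˡ E H)) + count (at? v ∘ (E H ↑ʳ_))      ≡⟨ count-↑ˡ↑ʳ (E H) (at? v) ⟨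
    count (at? v)                                              ∎
    where
      open ≡-Reasoning
      first? : Decidable (λ e → proj₁ (ends H e) ≡ v)
      first? e = proj₁ (ends H e) ≟ v
      second? : Decidable (λ e → proj₂ (ends H e) ≡ v)
      second? e = proj₂ (ends H e) ≟ v
      not-both : ∀ {e} → proj₁ (ends H e) ≡ v → proj₂ (ends H e) ≢ v
      not-both first≡v second≡v = loopless H _ (trans first≡v (sym second≡v))
      first-ends : (λ e → proj₁ (ends H e) ≡ v) ≐ (λ e → dartEnd (e ↑ˡ E H) ≡ v)
      first-ends = (λ {e} eq → trans (dartEnd-↑ˡ e) eq) , (λ {e} eq → trans (sym (dartEnd-↑ˡ e)) eq)
      second-ends : (λ e → proj₂ (ends H e) ≡ v) ≐ (λ e → dartEnd (E H ↑ʳ e) ≡ v)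
      second-ends = (λ {e} eq → trans (dartEnd-↑ʳ e) eq) , (λ {e} eq → trans (sym (dartEnd-↑ʳ e)) eq)

  degree-branch : ∀ v → degree G (v ↑ˡ E H) ≡ degree H v
  degree-branch v = trans (degree≡count G _) (trans (count-cong _ (at? v) (incident-branch v)) (sym (degree-darts v)))

  degree-subdivider : ∀ e → degree G (V H ↑ʳ e) ≡ 2
  degree-subdivider e = begin
    degree G (V H ↑ʳ e)                                    ≡⟨ degree≡count G _ ⟩
    count (incident? G (V H ↑ʳ e))                          ≡⟨ count-cong _ of-e? (incident-subdivider e) ⟩
    count of-e?                                             ≡⟨ count-↑ˡ↑ʳ (E H) of-e? ⟩
    count (of-e? ∘ (_↑ˡ E H)) + count (of-e? ∘ (E H ↑ʳ_))  ≡⟨ cong₂ _+_ (count-cong _ (_≟ e) first-darts)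
                                                                        (count-cong _ (_≟ e) second-darts) ⟩
    count (_≟ e) + count (_≟ e)                             ≡⟨ cong₂ _+_ (count-≡ e) (count-≡ e) ⟩
    2                                                       ∎
    where
      open ≡-Reasoning
      of-e? : Decidable (λ h → dartEdge h ≡ e)
      of-e? h = dartEdge h ≟ e
      first-darts : (λ e' → dartEdge (e' ↑ˡ E H) ≡ e) ≐ (_≡ e)
      first-darts = (λ {e'} eq → trans (sym (dartEdge-↑ˡ e')) eq) , (λ {e'} eq → trans (dartEdge-↑ˡ e') eq)
      second-darts : (λ e' → dartEdge (E H ↑ʳ e') ≡ e) ≐ (_≡ e)
      second-darts = (λ {e'} eq → trans (sym (dartEdge-↑ʳ e')) eq) , (λ {e'} eq → trans (dartEdge-↑ʳ e') eq)

  maxDegree-subdivision : 2 ≤ maxDegree H → maxDegree G ≡ maxDegree H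
  maxDegree-subdivision 2≤Δ =
    ≤-antisym (maxDegree-lub G bounded)
              (maxDegree-lub H λ v → subst (_≤ maxDegree G) (degree-branch v) (degree≤maxDegree G _))
    where
      bounded : ∀ x → degree G x ≤ maxDegree H
      bounded x with ↑-view (V H) x
      ... | inj₁ (v , refl) = subst (_≤ maxDegree H) (sym (degree-branch v)) (degree≤maxDegree H v)
      ... | inj₂ (e , refl) = subst (_≤ maxDegree H) (sym (degree-subdivider e)) 2≤Δ

-- The cyclic interval colouring

edgeless-colouring : ∀ G t → ¬ Fin (E G) → CyclicIntervalColoring G t
edgeless-colouring G t edgeless = record
  { coloring = record { col = λ _ → 0 ; inRange = ⊥-elim ∘ edgeless ; proper = λ e → ⊥-elim (edgeless e) }
  ; cyclic   = λ v → inj₁ (∅-consecutive λ { c (e , _) → edgeless e })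
  }

distinct-cover-Fin2 : ∀ {x y : Fin 2} → x ≢ y → ∀ s → x ≡ s ⊎ y ≡ s
distinct-cover-Fin2 {zero}     {zero}     x≢y _          = contradiction refl x≢y
distinct-cover-Fin2 {suc zero} {suc zero} x≢y _          = contradiction refl x≢y
distinct-cover-Fin2 {zero}     {suc zero} _   zero       = inj₁ refl
distinct-cover-Fin2 {zero}     {suc zero} _   (suc zero) = inj₂ refl
distinct-cover-Fin2 {suc zero} {zero}     _   zero       = inj₂ refl
distinct-cover-Fin2 {suc zero} {zero}     _   (suc zero) = inj₁ refl

attachIf : ∀ {A P : Set} → Dec P → A → A ⊎ A
attachIf (yes _) a = inj₁ a
attachIf (no _)  a = inj₂ a

attachIf-inj₁ : ∀ {A P : Set} {d : Dec P} {a b : A} → attachIf d a ≡ inj₁ b → P × a ≡ b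
attachIf-inj₁ {d = yes p} eq = p , inj₁-injective eq

attachIf-injective : ∀ {A P Q : Set} (d : Dec P) (d' : Dec Q) {a a' : A} → attachIf d a ≡ attachIf d' a' → a ≡ a'
attachIf-injective (yes _) (yes _) eq = inj₁-injective eq
attachIf-injective (no _)  (no _)  eq = inj₂-injective eq

module CyclicColouring (H : Graph) (k' : ℕ) (maxDegree≡ : maxDegree H ≡ suc k' * 2)
                       (degree≥ : ∀ v → k' * 2 ≤ degree H v) where

  open Darts H

  K : ℕ
  K = suc k'

  last : Fin K
  last = fromℕ k'

  darts≤ : ∀ v → count (at? v) ≤ K * 2
  darts≤ v = subst₂ _≤_ (degree-darts v) maxDegree≡ (degree≤maxDegree H v)

  position : Dart → Fin (K * 2)
  position h = fromℕ< (<-≤-trans (rank<count (at? (dartEnd h)) refl) (darts≤ (dartEnd h)))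

  position-injective : Proper dartEnd position
  position-injective h h' ends positions = rank-injective (at? (dartEnd h)) refl (sym ends) ranks
    where
      ranks : rank (at? (dartEnd h)) h ≡ rank (at? (dartEnd h)) h'
      ranks = trans (sym (toℕ-fromℕ< _))
                    (trans (cong toℕ positions) (trans (toℕ-fromℕ< _) (cong (λ v → rank (at? v) h') (sym ends))))

  dart-at-position : ∀ v (p : Fin (K * 2)) → toℕ p < degree H v → ∃ λ h → dartEnd h ≡ v × position h ≡ p
  dart-at-position v p p<degree with rank-surjective (at? v) (subst (toℕ p <_) (degree-darts v) p<degree)
  ... | h , at-v , rank≡p =
    h , at-v , toℕ-injective (trans (toℕ-fromℕ< _) (trans (cong (λ u → rank (at? u) h) at-v) rank≡p))

  slot : Dart → Fin K
  slot h = quotient 2 (position h)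

  parity : Dart → Fin 2
  parity h = remainder {K} 2 (position h)

  EndSlot : Dart → Fin (V H) × Fin K
  EndSlot h = dartEnd h , slot h

  parity-proper : Proper EndSlot parity
  parity-proper h h' end-slots parities = position-injective h h' (cong proj₁ end-slots)
    (trans (sym (combine-remQuot {K} 2 (position h)))
           (trans (cong₂ combine (cong proj₂ end-slots) parities) (combine-remQuot {K} 2 (position h'))))

  opaque
    orientation : ∃ λ (o : Dart → Fin 2) → Proper EndSlot o × Proper dartEdge o
    orientation = Bipartite.edge-colouring (×-≡-dec _≟_ _≟_) _≟_ EndSlot dartEdge parity-proper dartSide-proper

  o : Dart → Fin 2
  o = proj₁ orientation

  o-proper-slot : Proper EndSlot o
  o-proper-slot = proj₁ (proj₂ orientation)

  o-proper-edge : Proper dartEdge o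
  o-proper-edge = proj₂ (proj₂ orientation)

  dart : Fin 2 → Fin (E H) → Dart
  dart s e = proj₁ (saturated-transfer dartSide-proper o-proper-edge (dartSide-saturated e) s)

  dartEdge-dart : ∀ s e → dartEdge (dart s e) ≡ e
  dartEdge-dart s e = proj₁ (proj₂ (saturated-transfer dartSide-proper o-proper-edge (dartSide-saturated e) s))

  o-dart : ∀ s e → o (dart s e) ≡ s
  o-dart s e = proj₂ (proj₂ (saturated-transfer dartSide-proper o-proper-edge (dartSide-saturated e) s))

  dart-unique : ∀ {h s} → o h ≡ s → dart s (dartEdge h) ≡ h
  dart-unique {h} o≡s = o-proper-edge _ h (dartEdge-dart _ _) (trans (o-dart _ _) (sym o≡s))

  slot-parity-of-position : ∀ {h j t} → position h ≡ combine j t → slot h ≡ j × parity h ≡ t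
  slot-parity-of-position {h} {j} {t} position≡ = cong proj₁ remQuot≡ , cong proj₂ remQuot≡
    where
      remQuot≡ : remQuot {K} 2 (position h) ≡ (j , t)
      remQuot≡ = trans (cong (remQuot {K} 2) position≡) (remQuot-combine j t)

  lower-slot<degree : ∀ v {j} → j <ᶠ last → ∀ t → toℕ (combine j t) < degree H v
  lower-slot<degree v j<last t =
    <-≤-trans (combine-monoˡ-< t (zero {n = 1}) j<last) (subst (_≤ degree H v) last-slot≡ (degree≥ v))
    where
      last-slot≡ : k' * 2 ≡ toℕ (combine last (zero {n = 1}))
      last-slot≡ = sym (trans (toℕ-combine last zero)
                              (trans (+-identityʳ _) (trans (cong (2 *_) (toℕ-fromℕ k')) (*-comm 2 k'))))

  slot-occupied : ∀ v {j} → j <ᶠ last → ∀ t → ∃ λ h → dartEnd h ≡ v × slot h ≡ j × parity h ≡ t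
  slot-occupied v j<last t =
    let h , at-v , position≡ = dart-at-position v _ (lower-slot<degree v j<last t)
    in h , at-v , slot-parity-of-position {h} position≡

  -- A slot below the last one is full, so it holds a dart of either orientation.
  lower-slot-oriented : ∀ v {j} → j <ᶠ last → ∀ s → ∃ λ h → dartEnd h ≡ v × slot h ≡ j × o h ≡ s
  lower-slot-oriented v {j} j<last s = pick (slot-occupied v j<last zero) (slot-occupied v j<last (suc zero))
    where
      Occupant : Fin 2 → Set
      Occupant t = ∃ λ h → dartEnd h ≡ v × slot h ≡ j × parity h ≡ t
      pick : Occupant zero → Occupant (suc zero) → ∃ λ h → dartEnd h ≡ v × slot h ≡ j × o h ≡ s
      pick (h₀ , at₀ , slot₀ , parity₀) (h₁ , at₁ , slot₁ , parity₁) =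
        [ (λ o₀≡s → h₀ , at₀ , slot₀ , o₀≡s) , (λ o₁≡s → h₁ , at₁ , slot₁ , o₁≡s) ] (distinct-cover-Fin2 o-differs s)
        where
          o-differs : o h₀ ≢ o h₁
          o-differs same = contradiction (trans (sym parity₀) (trans (cong parity h₀≡h₁) parity₁)) λ ()
            where
              h₀≡h₁ : h₀ ≡ h₁
              h₀≡h₁ = o-proper-slot h₀ h₁ (cong₂ _,_ (trans at₀ (sym at₁)) (trans slot₀ (sym slot₁))) same

  LastSlotFree : Fin 2 → Fin (V H) → Set
  LastSlotFree s v = ¬ ∃ λ h → dartEnd h ≡ v × slot h ≡ last × o h ≡ s

  lastSlotFree? : ∀ s v → Dec (LastSlotFree s v)
  lastSlotFree? s v = ¬? (any? λ h → (dartEnd h ≟ v) ×-dec ((slot h ≟ last) ×-dec (o h ≟ s)))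

  -- Side s of the auxiliary bipartite graph: the edge inj₁ e ends at the orientation-s dart of e, and the filler edge
  -- inj₂ v ends at v if the last slot of v is free on side s, and at a private copy of v otherwise.
  AuxEdge : Set
  AuxEdge = Fin (E H) ⊎ Fin (V H)

  auxEnd : Fin 2 → AuxEdge → Fin (V H) ⊎ Fin (V H)
  auxEnd s (inj₁ e) = inj₁ (dartEnd (dart s e))
  auxEnd s (inj₂ v) = attachIf (lastSlotFree? s v) v

  auxSlot : Fin 2 → AuxEdge → Fin K
  auxSlot s (inj₁ e) = slot (dart s e)
  auxSlot s (inj₂ v) = last

  auxSlot-proper : ∀ s → Proper (auxEnd s) (auxSlot s)
  auxSlot-proper s (inj₁ e) (inj₁ e') ends slots =
    cong inj₁ (trans (sym (dartEdge-dart s e)) (trans (cong dartEdge same-dart) (dartEdge-dart s e')))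
    where
      same-dart : dart s e ≡ dart s e'
      same-dart = o-proper-slot _ _ (cong₂ _,_ (inj₁-injective ends) slots) (trans (o-dart s e) (sym (o-dart s e')))
  auxSlot-proper s (inj₁ e) (inj₂ v) ends slots =
    let free , v≡ = attachIf-inj₁ (sym ends) in contradiction (dart s e , sym v≡ , slots , o-dart s e) free
  auxSlot-proper s (inj₂ v) (inj₁ e) ends slots =
    let free , v≡ = attachIf-inj₁ ends in contradiction (dart s e , sym v≡ , sym slots , o-dart s e) free
  auxSlot-proper s (inj₂ v) (inj₂ v') ends _ = cong inj₂ (attachIf-injective (lastSlotFree? s v) (lastSlotFree? s v') ends)

  auxSlot-saturated : ∀ s v → Saturated (auxEnd s) (auxSlot s) (inj₁ v)
  auxSlot-saturated s v j with any? (λ h → (dartEnd h ≟ v) ×-dec ((slot h ≟ j) ×-dec (o h ≟ s)))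
  ... | yes (h , at-v , slot≡j , o≡s) = inj₁ (dartEdge h) , cong inj₁ (trans (cong dartEnd (dart-unique o≡s)) at-v)
                                                         , trans (cong slot (dart-unique o≡s)) slot≡j
  ... | no ¬occupied with j ≟ last
  ...   | yes refl  = inj₂ v , free-attached , refl
    where
      free-attached : attachIf (lastSlotFree? s v) v ≡ inj₁ v
      free-attached with lastSlotFree? s v
      ... | yes _    = refl
      ... | no ¬free = contradiction ¬occupied ¬free
  ...   | no j≢last = contradiction (lower-slot-oriented v (≤∧≢⇒< (≤fromℕ j) j≢last) s) ¬occupied

  opaque
    aux-colouring : ∃ λ (β : AuxEdge → Fin K) → Proper (auxEnd zero) β × Proper (auxEnd (suc zero)) β
    aux-colouring = Bipartite.edge-colouring-⊎ (⊎-≡-dec _≟_ _≟_) (⊎-≡-dec _≟_ _≟_) (auxEnd zero) (auxEnd (suc zero))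
                                              (auxSlot-proper zero) (auxSlot-proper (suc zero))

  β : AuxEdge → Fin K
  β = proj₁ aux-colouring

  β-proper : ∀ s → Proper (auxEnd s) β
  β-proper zero       = proj₁ (proj₂ aux-colouring)
  β-proper (suc zero) = proj₂ (proj₂ aux-colouring)

  β-saturated : ∀ s v → Saturated (auxEnd s) β (inj₁ v)
  β-saturated s v = saturated-transfer (auxSlot-proper s) (β-proper s) (auxSlot-saturated s v)

  dartColour : Dart → ℕ
  dartColour h = colour (β (inj₁ (dartEdge h))) (o h)

  dartColour-proper-at-ends : Proper dartEnd dartColour
  dartColour-proper-at-ends h h' ends colours with colour-injective colours
  ... | βs , os = o-proper-edge h h' (inj₁-injective (β-proper (o h) _ _ aux-ends βs)) os
    where
      aux-ends : auxEnd (o h) (inj₁ (dartEdge h)) ≡ auxEnd (o h) (inj₁ (dartEdge h'))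
      aux-ends = cong inj₁ (trans (cong dartEnd (dart-unique refl)) (trans ends (cong dartEnd (sym (dart-unique (sym os))))))

  dartColour-proper-at-edges : Proper dartEdge dartColour
  dartColour-proper-at-edges h h' edges colours = o-proper-edge h h' edges (proj₂ (colour-injective colours))

  maxDegree-G : maxDegree G ≡ K * 2
  maxDegree-G = trans (maxDegree-subdivision (subst (2 ≤_) (sym maxDegree≡) (s≤s (s≤s z≤n)))) maxDegree≡

  colouring : ProperEdgeColoring G (maxDegree G)
  colouring = record
    { col     = dartColour
    ; inRange = λ h → 1≤colour _ _ , subst (dartColour h ≤_) (sym maxDegree-G) (colour≤ _ _)
    ; proper  = no-adjacent-clash
    }
    where
      no-adjacent-clash : ∀ h h' → Adjacent G h h' → dartColour h ≢ dartColour h'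
      no-adjacent-clash h h' (h≢h' , x , inc , inc') colours
        with incident-subdivision x h inc | incident-subdivision x h' inc'
      ... | inj₁ at | inj₁ at' = h≢h' (dartColour-proper-at-ends h h' (↑ˡ-injective _ _ _ (trans at (sym at'))) colours)
      ... | inj₂ at | inj₂ at' = h≢h' (dartColour-proper-at-edges h h' (↑ʳ-injective _ _ _ (trans at (sym at'))) colours)
      ... | inj₁ at | inj₂ at' = ↑ˡ≢↑ʳ _ _ (trans at (sym at'))
      ... | inj₂ at | inj₁ at' = ↑ˡ≢↑ʳ _ _ (trans at' (sym at))

  Absent : Fin (V G) → ℕ → Set
  Absent x c = (1 ≤ c × c ≤ maxDegree G) × ¬ InS colouring x c

  present? : ∀ x c → Dec (InS colouring x c)
  present? x c = any? λ h → incident? G x h ×-dec (dartColour h ℕ.≟ c)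

  absent? : ∀ x c → Dec (Absent x c)
  absent? x c = ((1 ≤? c) ×-dec (c ≤? maxDegree G)) ×-dec ¬? (present? x c)

  present-at-subdivider : ∀ e c → InS colouring (V H ↑ʳ e) c →
                          c ≡ colour (β (inj₁ e)) zero ⊎ c ≡ suc (colour (β (inj₁ e)) zero)
  present-at-subdivider e c (h , inc , refl) with proj₁ (incident-subdivider e) inc
  ... | refl = colour-pair _ (o h)

  absent-at-branch : ∀ v c → Absent (v ↑ˡ E H) c →
                     c ≡ colour (β (inj₂ v)) zero ⊎ c ≡ suc (colour (β (inj₂ v)) zero)
  absent-at-branch v c ((1≤c , c≤Δ) , unused) =
    let j , s , colour≡c = colour-surjective 1≤c (subst (c ≤_) maxDegree-G c≤Δ)
    in subst FillerColour colour≡c (filler-colour j s (subst (¬_ ∘ InS colouring (v ↑ˡ E H)) (sym colour≡c) unused))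
    where
      FillerColour : ℕ → Set
      FillerColour c = c ≡ colour (β (inj₂ v)) zero ⊎ c ≡ suc (colour (β (inj₂ v)) zero)
      filler-colour : ∀ j s → ¬ InS colouring (v ↑ˡ E H) (colour j s) → FillerColour (colour j s)
      filler-colour j s unused = via-saturation (β-saturated s v j)
        where
          via-saturation : (∃ λ x → auxEnd s x ≡ inj₁ v × β x ≡ j) → FillerColour (colour j s)
          via-saturation (inj₁ e , at-v , β≡j) = contradiction (dart s e , incident , coloured) unused
            where
              incident : Incident G (v ↑ˡ E H) (dart s e)
              incident = proj₂ (incident-branch v) (inj₁-injective at-v)
              coloured : dartColour (dart s e) ≡ colour j s
              coloured = cong₂ colour (trans (cong (β ∘ inj₁) (dartEdge-dart s e)) β≡j) (o-dart s e)
          via-saturation (inj₂ v' , at-v , β≡j) =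
            subst (λ j → FillerColour (colour j s)) (trans (cong (β ∘ inj₂) (sym (proj₂ (attachIf-inj₁ at-v)))) β≡j)
                  (colour-pair (β (inj₂ v)) s)

  cyclic-interval-colouring : CyclicIntervalColoring G (maxDegree G)
  cyclic-interval-colouring = record { coloring = colouring ; cyclic = interval-at }
    where
      interval-at : ∀ x → Consecutive (InS colouring x) ⊎ Consecutive (Absent x)
      interval-at x with ↑-view (V H) x
      ... | inj₁ (v , refl) = inj₂ (pair-consecutive (absent? _) (absent-at-branch v))
      ... | inj₂ (e , refl) = inj₁ (pair-consecutive (present? _) (present-at-subdivider e))

corollary2 : (H : Graph) → 2 ∣ maxDegree H → maxDegree H ∸ minDegree H ≤ 2 →
    CyclicIntervalColoring (fullSubdivision H) (maxDegree (fullSubdivision H))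
corollary2 H (divides zero Δ≡0) _ = edgeless-colouring _ _ (maxDegree≡0⇒edgeless H Δ≡0 ∘ Darts.dartEdge H)
corollary2 H (divides (suc k') Δ≡) spread≤2 = CyclicColouring.cyclic-interval-colouring H k' Δ≡ degree≥
  where
    degree≥ : ∀ v → k' * 2 ≤ degree H v
    degree≥ v = +-cancelˡ-≤ 2 _ _ (subst (_≤ 2 + degree H v) Δ≡
                  (≤-trans (maxDegree≤spread+degree H v) (+-monoˡ-≤ (degree H v) spread≤2)))
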